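{- Let $n\geq 8$ and let $x,y$ be two distinct vertices of $K_n$. Then in the Waiter-Client game on $K_n$, within $n$ rounds Waiter can force Client to build a red Hamilton path between $x$ and $y$ in $K_n$.
   Context: The unbiased Waiter-Client game on $K_n$: in each round Waiter offers Client two previously unclaimed (free) edges of $K_n$; Client chooses one of them, which becomes red (Client's), and the other becomes blue (Waiter's). Waiter "forces" a graph within $t$ rounds if she has a strategy guaranteeing that after at most $t$ rounds the red graph contains it. -}

module Defs where

open import Data.Nat using (ℕ; zero; suc)
open import Data.Fin using (Fin)
open import Data.Product using (_×_; _,_; Σ)
open import Data.Sum using (_⊎_)
open import Data.List using (List; []; _∷_; length)
open import Data.List.Membership.Propositional using (_∈_)
open import Data.List.Relation.Unary.Unique.Propositional using (Unique)
open import Relation.Binary.PropositionalEquality using (_≡_; _≢_)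
open import Relation.Nullary using (¬_)

-- An edge of K_n is given by an ordered pair of vertices (endpoints);
-- (u , v) and (v , u) denote the same edge.
Edge : ℕ → Set
Edge n = Fin n × Fin n

SameEdge : ∀ {n} → Edge n → Edge n → Set
SameEdge (a , b) (c , d) = (a ≡ c × b ≡ d) ⊎ (a ≡ d × b ≡ c)

Adj : ∀ {n} → List (Edge n) → Fin n → Fin n → Set
Adj E u v = ((u , v) ∈ E) ⊎ ((v , u) ∈ E)

Free : ∀ {n} → List (Edge n) → Edge n → Set
Free C (u , v) = (u ≢ v) × ¬ Adj C u v

data Path {n : ℕ} (R : List (Edge n)) : Fin n → Fin n → List (Fin n) → Set where
  single : ∀ {x} → Path R x x (x ∷ [])
  step   : ∀ {x z y l} → Adj R x z → Path R z y l → Path R x y (x ∷ l)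

HamPath : ∀ {n} → List (Edge n) → Fin n → Fin n → Set
HamPath {n} R x y = Σ (List (Fin n)) λ l → Path R x y l × Unique l × length l ≡ n

-- Forces x y t R C : in the unbiased Waiter-Client game on K_n, from the
-- position with red (Client) edges R and claimed (red or blue) edges C,
-- Waiter can guarantee that within at most t further rounds the red graph
-- contains a Hamilton path between x and y.
-- In a round Waiter offers two distinct free edges e₁ e₂; Client picks one
-- (it becomes red), the other becomes blue.
data Forces {n : ℕ} (x y : Fin n) : ℕ → List (Edge n) → List (Edge n) → Set where
  done  : ∀ {t R C} → HamPath R x y → Forces x y t R C
  round : ∀ {t R C} (e₁ e₂ : Edge n) →
          Free C e₁ → Free C e₂ → ¬ SameEdge e₁ e₂ →
          Forces x y t (e₁ ∷ R) (e₁ ∷ e₂ ∷ C) →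
          Forces x y t (e₂ ∷ R) (e₁ ∷ e₂ ∷ C) →
          Forces x y (suc t) R C

-- Waiter grows the path greedily from x: she offers xa and xb for two vertices
-- a, b ∉ {x, y}.  Whichever edge Client takes, say xa, what remains is the same
-- game on K_{n-1} = K_n − x from a to y, and the two claimed edges touch x, so
-- they are invisible there.  One round per vertex brings n down to 8, where a
-- strategy tree found by computer search is checked by evaluation and then
-- relabelled to move its endpoints to x and y.

module Submission where

open import Defs
open import Data.Nat.Base using (ℕ; zero; suc; _+_; _≤_)
import Data.Nat.Properties as ℕ
open import Data.Nat.Properties using (m≤n⇒∃[o]m+o≡n)
open import Data.Fin.Base using (Fin; punchIn; punchOut)
open import Data.Fin.Patterns using (0F; 1F; 2F; 3F; 4F; 5F; 6F; 7F)
open import Data.Fin.Permutation.Components using (transpose)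
open import Data.Fin.Properties using (_≟_; punchIn-injective; punchInᵢ≢i; punchIn-punchOut)
open import Data.Fin.Permutation using (Permutation′; _⟨$⟩ʳ_; insert; id)
open import Data.List.Base using (List; []; _∷_; map; length)
open import Data.List.Properties using (length-map)
open import Data.List.Relation.Unary.Any using (here; there)
open import Data.List.Relation.Unary.All using (All; []; _∷_; universal; lookup)
import Data.List.Relation.Unary.All.Properties as All
open import Data.List.Relation.Unary.AllPairs using (_∷_)
open import Data.List.Relation.Unary.Unique.Propositional using (Unique)
import Data.List.Relation.Unary.Unique.Propositional.Properties as Unique
open import Data.List.Relation.Binary.Subset.Propositional using (_⊆_)
open import Data.List.Relation.Binary.Subset.Propositional.Properties using (⊆-refl; ⊆-trans; xs⊆x∷xs)
import Data.List.Membership.DecPropositional as Membership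
import Data.List.Relation.Unary.Unique.DecPropositional as UniqueDec
open import Data.Product.Properties using (≡-dec)
open import Data.Product.Base using (_,_; proj₁)
import Data.Product.Base as Product
open import Data.Sum.Base using (_⊎_; inj₁; inj₂; [_,_])
import Data.Sum.Base as Sum
open import Function.Base using (_∘_)
open import Function.Bundles using (Injection)
open import Function.Definitions using (Injective)
open import Function.Properties.Inverse using (↔⇒↣)
open import Relation.Binary.PropositionalEquality using (_≡_; _≢_; refl; sym; trans; cong; subst)
open import Relation.Nullary using (¬_; yes; no)
open import Relation.Nullary.Decidable using (Dec; ¬?; _×-dec_; _⊎-dec_)
open import Data.Empty using (⊥-elim)
open import Data.Maybe.Base using (Maybe; just; nothing; from-just)

private
  variable
    m n k : ℕ
    u v : Fin n
    e f : Edge n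
    E : List (Edge n)

Adj-[] : ¬ Adj {n} [] u v
Adj-[] (inj₁ ())
Adj-[] (inj₂ ())

Adj-there : Adj E u v → Adj (e ∷ E) u v
Adj-there = Sum.map there there

Adj-∷⁺ : SameEdge (u , v) e → Adj (e ∷ E) u v
Adj-∷⁺ (inj₁ (refl , refl)) = inj₁ (here refl)
Adj-∷⁺ (inj₂ (refl , refl)) = inj₂ (here refl)

Adj-∷⁻ : Adj (e ∷ E) u v → SameEdge (u , v) e ⊎ Adj E u v
Adj-∷⁻ (inj₁ (here refl)) = inj₁ (inj₁ (refl , refl))
Adj-∷⁻ (inj₂ (here refl)) = inj₁ (inj₂ (refl , refl))
Adj-∷⁻ (inj₁ (there p))   = inj₂ (inj₁ p)
Adj-∷⁻ (inj₂ (there p))   = inj₂ (inj₂ p)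

mapEdge : (Fin m → Fin n) → Edge m → Edge n
mapEdge g (u , v) = g u , g v

module _ (g : Fin m → Fin n) where

  SameEdge-map⁺ : SameEdge e f → SameEdge (mapEdge g e) (mapEdge g f)
  SameEdge-map⁺ (inj₁ (refl , refl)) = inj₁ (refl , refl)
  SameEdge-map⁺ (inj₂ (refl , refl)) = inj₂ (refl , refl)

  SameEdge-map⁻ : Injective _≡_ _≡_ g → SameEdge (mapEdge g e) (mapEdge g f) → SameEdge e f
  SameEdge-map⁻ g-inj = Sum.map (Product.map g-inj g-inj) (Product.map g-inj g-inj)

  Path-map : {R : List (Edge m)} {E : List (Edge n)} →
             (∀ {i j} → Adj R i j → Adj E (g i) (g j)) →
             ∀ {a b l} → Path R a b l → Path E (g a) (g b) (map g l)
  Path-map hom single     = single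
  Path-map hom (step a p) = step (hom a) (Path-map hom p)

module Transport (g : Fin m → Fin n) (g-inj : Injective _≡_ _≡_ g) {s t : Fin m} {x y : Fin n} where

  Homomorphic : List (Edge m) → List (Edge n) → Set
  Homomorphic R E = ∀ {i j} → Adj R i j → Adj E (g i) (g j)

  Reflecting : List (Edge n) → List (Edge m) → Set
  Reflecting E C = ∀ {i j} → Adj E (g i) (g j) → Adj C i j

  -- E already contains the part of an x–y Hamilton path of K_n that lies
  -- outside the image of g.
  Completes : List (Edge n) → Set
  Completes E = ∀ {F} → E ⊆ F → ∀ {l} → Path F (g s) (g t) (map g l) → Unique l → length l ≡ m →
                HamPath F x y

  Homomorphic-∷ : ∀ {R E} → Homomorphic R E → Homomorphic (e ∷ R) (mapEdge g e ∷ E)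
  Homomorphic-∷ hom = [ Adj-∷⁺ ∘ SameEdge-map⁺ g , Adj-there ∘ hom ] ∘ Adj-∷⁻

  Reflecting-∷ : ∀ {E C} → Reflecting E C → Reflecting (mapEdge g e ∷ E) (e ∷ C)
  Reflecting-∷ ref = [ Adj-∷⁺ ∘ SameEdge-map⁻ g g-inj , Adj-there ∘ ref ] ∘ Adj-∷⁻

  Completes-∷ : Completes E → Completes (e ∷ E)
  Completes-∷ complete = complete ∘ ⊆-trans (xs⊆x∷xs _ _)

  Free-map : ∀ {E C} → Reflecting E C → Free C e → Free E (mapEdge g e)
  Free-map ref (i≢j , free) = i≢j ∘ g-inj , free ∘ ref

  Forces-map : ∀ {R C E D} → Homomorphic R E → Reflecting D C → Completes E →
               Forces s t k R C → Forces x y k E D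
  Forces-map hom ref complete (done (l , p , unique , len)) =
    done (complete ⊆-refl (Path-map g hom p) unique len)
  Forces-map {C = C} {D = D} hom ref complete (round e₁ e₂ free₁ free₂ e₁≉e₂ win₁ win₂) =
    round (mapEdge g e₁) (mapEdge g e₂) (Free-map ref free₁) (Free-map ref free₂)
          (e₁≉e₂ ∘ SameEdge-map⁻ g g-inj)
          (Forces-map (Homomorphic-∷ hom) ref′ (Completes-∷ complete) win₁)
          (Forces-map (Homomorphic-∷ hom) ref′ (Completes-∷ complete) win₂)
    where
    ref′ : Reflecting (mapEdge g e₁ ∷ mapEdge g e₂ ∷ D) (e₁ ∷ e₂ ∷ C)
    ref′ = Reflecting-∷ (Reflecting-∷ ref)

Forces-relabel : (π : Permutation′ n) {s t : Fin n} →
                 Forces s t k [] [] → Forces (π ⟨$⟩ʳ s) (π ⟨$⟩ʳ t) k [] []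
Forces-relabel π = Forces-map (⊥-elim ∘ Adj-[]) (⊥-elim ∘ Adj-[]) complete
  where
  π-inj : Injective _≡_ _≡_ (π ⟨$⟩ʳ_)
  π-inj = Injection.injective (↔⇒↣ π)
  open Transport (π ⟨$⟩ʳ_) π-inj
  complete : Completes []
  complete _ {l} p unique len =
    map (π ⟨$⟩ʳ_) l , p , Unique.map⁺ π-inj unique , trans (length-map _ l) len

Forces-prepend : (x : Fin (suc m)) {y : Fin (suc m)} {s t : Fin m} {C : List (Edge (suc m))} →
                 punchIn x t ≡ y → All (λ e → proj₁ e ≡ x) C →
                 Forces s t k [] [] → Forces x y k ((x , punchIn x s) ∷ []) C
Forces-prepend x {s = s} {t} {C} refl from-x =
  Forces-map (⊥-elim ∘ Adj-[]) (⊥-elim ∘ avoids-x) complete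
  where
  open Transport (punchIn x) (punchIn-injective x _ _) {s} {t} {x} {punchIn x t}
  avoids-x : ∀ {i j} → ¬ Adj C (punchIn x i) (punchIn x j)
  avoids-x {i} (inj₁ e∈C) = punchInᵢ≢i x i (lookup from-x e∈C)
  avoids-x {j = j} (inj₂ e∈C) = punchInᵢ≢i x j (lookup from-x e∈C)
  x∉image : ∀ l → All (x ≢_) (map (punchIn x) l)
  x∉image l = All.map⁺ (universal (λ i → punchInᵢ≢i x i ∘ sym) l)
  complete : Completes ((x , punchIn x s) ∷ [])
  complete E⊆F {l} p unique len =
    x ∷ map (punchIn x) l , step (inj₁ (E⊆F (here refl))) p ,
    x∉image l ∷ Unique.map⁺ (punchIn-injective x _ _) unique ,
    cong suc (trans (length-map _ l) len)

-- Sends 0F to x and 1F to punchIn x (punchOut x≢y), definitionally.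
pinned : (x y : Fin (suc (suc n))) → x ≢ y → Permutation′ (suc (suc n))
pinned x y x≢y = insert 0F x (insert 0F (punchOut x≢y) id)

Forces-endpoints : Forces 0F 1F k [] [] → (x y : Fin (suc (suc n))) → x ≢ y → Forces x y k [] []
Forces-endpoints win x y x≢y =
  subst (λ z → Forces x z _ [] []) (punchIn-punchOut x≢y) (Forces-relabel (pinned x y x≢y) win)

Forces-suc : ((s t : Fin (3 + m)) → s ≢ t → Forces s t (3 + m) [] []) →
             (x y : Fin (4 + m)) → x ≢ y → Forces x y (4 + m) [] []
Forces-suc {m} forces x y x≢y =
  round (x , a) (x , b) (punchInᵢ≢i x a′ ∘ sym , Adj-[]) (punchInᵢ≢i x b′ ∘ sym , Adj-[]) distinct
        (continue 0F) (continue 1F)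
  where
  y′ : Fin (3 + m)
  y′ = punchOut x≢y
  a′ b′ : Fin (3 + m)
  a′ = punchIn y′ 0F
  b′ = punchIn y′ 1F
  a b : Fin (4 + m)
  a = punchIn x a′
  b = punchIn x b′
  distinct : ¬ SameEdge (x , a) (x , b)
  distinct (inj₁ (_ , a≡b)) with punchIn-injective y′ 0F 1F (punchIn-injective x a′ b′ a≡b)
  ... | ()
  distinct (inj₂ (x≡b , _)) = punchInᵢ≢i x b′ (sym x≡b)
  continue : ∀ c → Forces x y (3 + m) ((x , punchIn x (punchIn y′ c)) ∷ []) ((x , a) ∷ (x , b) ∷ [])
  continue c =
    Forces-prepend x (punchIn-punchOut x≢y) (refl ∷ refl ∷ []) (forces _ y′ (punchInᵢ≢i y′ c))

data Strategy (n : ℕ) : Set where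
  claim : List (Fin n) → Strategy n
  offer : Edge n → Edge n → Strategy n → Strategy n → Strategy n

rename : (Fin n → Fin n) → Strategy n → Strategy n
rename π (claim l)           = claim (map π l)
rename π (offer e₁ e₂ s₁ s₂) = offer (mapEdge π e₁) (mapEdge π e₂) (rename π s₁) (rename π s₂)

-- Meant for π an automorphism of the current position that swaps e₁ and e₂;
-- nothing relies on this, as checkStrategy verifies the expanded tree.
mirror : Edge n → Edge n → (Fin n → Fin n) → Strategy n → Strategy n
mirror e₁ e₂ π s = offer e₁ e₂ s (rename π s)

adj? : (E : List (Edge n)) (u v : Fin n) → Dec (Adj E u v)
adj? E u v = ((u , v) ∈? E) ⊎-dec ((v , u) ∈? E)
  where open Membership (≡-dec _≟_ _≟_) using (_∈?_)

free? : (C : List (Edge n)) (e : Edge n) → Dec (Free C e)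
free? C (u , v) = ¬? (u ≟ v) ×-dec ¬? (adj? C u v)

sameEdge? : (e f : Edge n) → Dec (SameEdge e f)
sameEdge? (a , b) (c , d) = ((a ≟ c) ×-dec (b ≟ d)) ⊎-dec ((a ≟ d) ×-dec (b ≟ c))

checkPath : (R : List (Edge n)) (u v : Fin n) (l : List (Fin n)) → Maybe (Path R u v l)
checkPath R u v []          = nothing
checkPath R u v (w ∷ [])    with w ≟ u | u ≟ v
... | yes refl | yes refl = just single
... | _        | _        = nothing
checkPath R u v (w ∷ z ∷ l) with w ≟ u | adj? R u z | checkPath R z v (z ∷ l)
... | yes refl | yes u~z | just p = just (step u~z p)
... | _        | _       | _      = nothing

checkHamPath : (R : List (Edge n)) (x y : Fin n) → List (Fin n) → Maybe (HamPath R x y)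
checkHamPath {n} R x y l with checkPath R x y l | UniqueDec.unique? _≟_ l | length l ℕ.≟ n
... | just p | yes u | yes len = just (l , p , u , len)
... | _      | _     | _       = nothing

checkStrategy : (x y : Fin n) → Strategy n → (t : ℕ) (R C : List (Edge n)) →
                Maybe (Forces x y t R C)
checkStrategy x y (claim l) t R C with checkHamPath R x y l
... | just h  = just (done h)
... | nothing = nothing
checkStrategy x y (offer e₁ e₂ s₁ s₂) zero    R C = nothing
checkStrategy x y (offer e₁ e₂ s₁ s₂) (suc t) R C
  with free? C e₁ | free? C e₂ | sameEdge? e₁ e₂
     | checkStrategy x y s₁ t (e₁ ∷ R) (e₁ ∷ e₂ ∷ C) | checkStrategy x y s₂ t (e₂ ∷ R) (e₁ ∷ e₂ ∷ C)
... | yes free₁ | yes free₂ | no e₁≉e₂ | just win₁ | just win₂ =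
  just (round e₁ e₂ free₁ free₂ e₁≉e₂ win₁ win₂)
... | _ | _ | _ | _ | _ = nothing

-- Obtained by computer search, then compressed with mirror.
K₈-strategy : Strategy 8
K₈-strategy =
  mirror (2F , 3F) (2F , 4F) (transpose 3F 4F)
    (mirror (2F , 5F) (2F , 6F) (transpose 5F 6F)
      (mirror (4F , 5F) (5F , 6F) (transpose 4F 6F)
        (offer (4F , 6F) (4F , 7F)
          (offer (6F , 7F) (3F , 7F)
            (offer (0F , 3F) (0F , 7F)
              (offer (2F , 7F) (4F , 1F)
                (mirror (5F , 1F) (7F , 1F) (transpose 4F 6F ∘ transpose 5F 7F)
                  (claim (0F ∷ 3F ∷ 2F ∷ 7F ∷ 6F ∷ 4F ∷ 5F ∷ 1F ∷ [])))
                (mirror (5F , 7F) (7F , 1F) (transpose 4F 7F)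
                  (claim (0F ∷ 3F ∷ 2F ∷ 5F ∷ 7F ∷ 6F ∷ 4F ∷ 1F ∷ []))))
              (offer (2F , 1F) (3F , 4F)
                (mirror (3F , 5F) (3F , 1F) (transpose 2F 3F)
                  (claim (0F ∷ 7F ∷ 6F ∷ 4F ∷ 5F ∷ 3F ∷ 2F ∷ 1F ∷ [])))
                (mirror (3F , 1F) (5F , 1F) (transpose 3F 5F)
                  (claim (0F ∷ 7F ∷ 6F ∷ 4F ∷ 5F ∷ 2F ∷ 3F ∷ 1F ∷ [])))))
            (offer (0F , 2F) (2F , 7F)
              (offer (6F , 1F) (7F , 1F)
                (mirror (0F , 7F) (5F , 7F) (transpose 2F 7F)
                  (claim (0F ∷ 7F ∷ 3F ∷ 2F ∷ 5F ∷ 4F ∷ 6F ∷ 1F ∷ [])))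
                (mirror (0F , 6F) (3F , 6F) (transpose 2F 6F ∘ transpose 4F 5F)
                  (claim (0F ∷ 6F ∷ 4F ∷ 5F ∷ 2F ∷ 3F ∷ 7F ∷ 1F ∷ []))))
              (offer (0F , 6F) (6F , 1F)
                (mirror (3F , 1F) (7F , 1F) (transpose 3F 7F)
                  (claim (0F ∷ 6F ∷ 4F ∷ 5F ∷ 2F ∷ 7F ∷ 3F ∷ 1F ∷ [])))
                (mirror (0F , 3F) (0F , 7F) (transpose 3F 7F)
                  (claim (0F ∷ 3F ∷ 7F ∷ 2F ∷ 5F ∷ 4F ∷ 6F ∷ 1F ∷ []))))))
          (mirror (6F , 7F) (3F , 6F) (transpose 2F 4F ∘ transpose 3F 7F)
            (offer (0F , 6F) (6F , 1F)
              (offer (2F , 1F) (3F , 4F)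
                (mirror (3F , 5F) (3F , 1F) (transpose 2F 3F)
                  (claim (0F ∷ 6F ∷ 7F ∷ 4F ∷ 5F ∷ 3F ∷ 2F ∷ 1F ∷ [])))
                (mirror (3F , 1F) (5F , 1F) (transpose 3F 5F)
                  (claim (0F ∷ 6F ∷ 7F ∷ 4F ∷ 5F ∷ 2F ∷ 3F ∷ 1F ∷ []))))
              (offer (0F , 2F) (0F , 4F)
                (mirror (0F , 3F) (3F , 5F) (transpose 2F 3F)
                  (claim (0F ∷ 3F ∷ 2F ∷ 5F ∷ 4F ∷ 7F ∷ 6F ∷ 1F ∷ [])))
                (mirror (0F , 3F) (3F , 7F) (transpose 2F 5F ∘ transpose 3F 4F)
                  (claim (0F ∷ 3F ∷ 2F ∷ 5F ∷ 4F ∷ 7F ∷ 6F ∷ 1F ∷ [])))))))))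

Forces-K₈ : Forces 0F 1F 8 [] []
Forces-K₈ = from-just (checkStrategy 0F 1F K₈-strategy 8 [] [])

Forces-8+m : ∀ m (x y : Fin (8 + m)) → x ≢ y → Forces x y (8 + m) [] []
Forces-8+m zero    = Forces-endpoints Forces-K₈
Forces-8+m (suc m) = Forces-suc (Forces-8+m m)

lemma3p2 : (n : ℕ) → 8 ≤ n → (x y : Fin n) → x ≢ y → Forces x y n [] []
lemma3p2 n 8≤n with m≤n⇒∃[o]m+o≡n 8≤n
... | m , refl = Forces-8+m m
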